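{- Let $G$ be a connected graph and $x\in V(G)$. Then $$\frac{n(G)-1}{\mathrm{ecc}_G(x)}\le v_x(G)\le n(G)-\mathrm{ecc}_G(x),$$ and both bounds are sharp.
   Context: All graphs are finite and simple; $n(G)$ is the order of $G$, and $\mathrm{ecc}_G(x)=\max_{y\in V(G)} d_G(x,y)$ is the eccentricity of $x$. For $x\in V(G)$, a set $S\subseteq V(G)\setminus\{x\}$ is an $x$-visibility set if for every $y\in S$ there exists a shortest $x,y$-path $P$ with $V(P)\cap S=\{y\}$; $v_x(G)$ is the maximum size of an $x$-visibility set. -}

module Defs where

open import Data.Nat using (ℕ; zero; suc; _+_; _*_; _∸_; _≤_)
open import Data.Bool using (Bool; true; false; T)
open import Data.Fin using (Fin)
open import Data.Fin.Subset using (Subset; _∈_; _∉_; ∣_∣)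
open import Data.List using (List; []; _∷_)
import Data.List.Membership.Propositional as LM
open import Data.Product using (Σ; _×_; _,_; ∃)
open import Relation.Binary.PropositionalEquality using (_≡_)

record Graph : Set where
  field
    n      : ℕ
    adj    : Fin n → Fin n → Bool
    irrefl : ∀ i → adj i i ≡ false
    sym    : ∀ i j → adj i j ≡ adj j i

open Graph public

Adj : (G : Graph) → Fin (n G) → Fin (n G) → Set
Adj G i j = T (adj G i j)

data Walk (G : Graph) : Fin (n G) → Fin (n G) → Set where
  here : ∀ x → Walk G x x
  step : ∀ {y z} x → Adj G x y → Walk G y z → Walk G x z

len : ∀ {G x y} → Walk G x y → ℕ
len (here _)     = 0
len (step _ _ w) = suc (len w)

vertices : ∀ {G x y} → Walk G x y → List (Fin (n G))
vertices (here x)     = x ∷ []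
vertices (step x _ w) = x ∷ vertices w

Connected : Graph → Set
Connected G = ∀ x y → Walk G x y

IsDist : (G : Graph) → Fin (n G) → Fin (n G) → ℕ → Set
IsDist G x y k = Σ (Walk G x y) (λ w → len w ≡ k) × (∀ (w : Walk G x y) → k ≤ len w)

IsShortest : ∀ {G x y} → Walk G x y → Set
IsShortest {G} {x} {y} w = ∀ (w' : Walk G x y) → len w ≤ len w'

IsEcc : (G : Graph) → Fin (n G) → ℕ → Set
IsEcc G x e = (∀ y k → IsDist G x y k → k ≤ e) × ∃ (λ y → IsDist G x y e)

IsVisSet : (G : Graph) → Fin (n G) → Subset (n G) → Set
IsVisSet G x S =
  x ∉ S ×
  (∀ y → y ∈ S →
     Σ (Walk G x y) (λ P → IsShortest P ×
       (∀ v → v LM.∈ vertices P → v ∈ S → v ≡ y)))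

IsVisNumber : (G : Graph) → Fin (n G) → ℕ → Set
IsVisNumber G x v =
  Σ (Subset (n G)) (λ S → IsVisSet G x S × ∣ S ∣ ≡ v) ×
  (∀ S → IsVisSet G x S → ∣ S ∣ ≤ v)

-- Write d for the distance from x and e = ecc(x). For i ≥ 1 the layer {y | d(y) = i} is an
-- x-visibility set, because every vertex of a geodesic to y other than y is closer to x; the e
-- layers cover V ∖ {x}, so n − 1 ≤ e · v. Conversely, let S be a visibility set and y₀ ∈ S a farthest
-- vertex of S, with d(y₀) = d₀ ≤ e. On a geodesic to y₀ that sees y₀, the vertices at distances
-- i < d₀ avoid S; on a geodesic to an eccentric vertex, those at distances d₀ < i ≤ e avoid S by
-- maximality. These e vertices have distinct distances, so |S| ≤ n − e. Both bounds are attained,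
-- with v = 1, at an end vertex of the path on k + 1 vertices.
module Submission where

open import Defs
open import Data.Bool using (false; T; T?; _∨_)
open import Data.Bool.Properties using (T-∨; ∨-comm)
open import Data.Empty using (⊥-elim)
open import Data.Fin using (Fin; toℕ; fromℕ; fromℕ<; punchIn) renaming (zero to fzero; suc to fsuc)
import Data.Fin.Properties as Finₚ
open import Data.Fin.Subset using (Subset; _∈_; _∉_; ∣_∣; ⁅_⁆; _∪_; ⊥; ∁; _⊆_; _-_; Empty; inside; outside)
open import Data.Fin.Subset.Properties
  using (_∈?_; Empty-unique; ∣⊥∣≡0; ∣p∣≤n; x∈⁅x⁆; x∈⁅y⁆⇒x≡y; ∣⁅x⁆∣≡1; ∣∁p∣≡n∸∣p∣; p⊆q⇒∣p∣≤∣q∣;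
         x∈p∪q⁺; x∉p⇒x∈∁p; x∈∁p⇒x∉p; x∈p∧x≢y⇒x∈p-y; x∈p⇒∣p-x∣<∣p∣)
import Data.List.Membership.Propositional as List
open import Data.List.Relation.Unary.Any using (here; there)
open import Data.Nat using (ℕ; zero; suc; _+_; _*_; _∸_; _≤_; _<_; _≡ᵇ_; z≤n; s≤s; z<s; _≟_; _<?_)
open import Data.Nat.Properties
open import Data.Product using (Σ; _×_; ∃; _,_; proj₁; proj₂)
open import Data.Sum using (_⊎_; inj₁; inj₂)
open import Data.Vec using ([]; _∷_; tabulate)
open import Data.Vec.Properties using ([]=⇒lookup; lookup⇒[]=; lookup∘tabulate)
open import Function using (_∘_)
open import Function.Bundles using (Equivalence)
open import Function.Definitions using (Injective)
open import Relation.Nullary using (Dec; yes; no; does)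
open import Relation.Nullary.Decidable using (dec-true; _×-dec_)
open import Relation.Binary.PropositionalEquality
  using (_≡_; _≢_; refl; cong; cong₂; subst; trans; module ≡-Reasoning) renaming (sym to ≡-sym)

module _ {N : ℕ} where

  satisfying : {P : Fin N → Set} → (∀ y → Dec (P y)) → Subset N
  satisfying P? = tabulate (does ∘ P?)

  ∈-satisfying⁻ : ∀ {P : Fin N → Set} (P? : ∀ y → Dec (P y)) {y} → y ∈ satisfying P? → P y
  ∈-satisfying⁻ P? {y} y∈ with P? y | trans (≡-sym (lookup∘tabulate (does ∘ P?) y)) ([]=⇒lookup y∈)
  ... | yes py | _  = py
  ... | no _   | ()

  ∈-satisfying⁺ : ∀ {P : Fin N → Set} (P? : ∀ y → Dec (P y)) {y} → P y → y ∈ satisfying P?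
  ∈-satisfying⁺ P? {y} py = lookup⇒[]= y (satisfying P?) (trans (lookup∘tabulate (does ∘ P?) y) (dec-true (P? y) py))

∣p∪q∣≤∣p∣+∣q∣ : ∀ {N} (p q : Subset N) → ∣ p ∪ q ∣ ≤ ∣ p ∣ + ∣ q ∣
∣p∪q∣≤∣p∣+∣q∣ []            []            = z≤n
∣p∪q∣≤∣p∣+∣q∣ (inside ∷ p)  (inside ∷ q)  = s≤s (≤-trans (∣p∪q∣≤∣p∣+∣q∣ p q) (+-monoʳ-≤ ∣ p ∣ (n≤1+n ∣ q ∣)))
∣p∪q∣≤∣p∣+∣q∣ (inside ∷ p)  (outside ∷ q) = s≤s (∣p∪q∣≤∣p∣+∣q∣ p q)
∣p∪q∣≤∣p∣+∣q∣ (outside ∷ p) (inside ∷ q)  = subst (suc ∣ p ∪ q ∣ ≤_) (≡-sym (+-suc ∣ p ∣ ∣ q ∣)) (s≤s (∣p∪q∣≤∣p∣+∣q∣ p q))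
∣p∪q∣≤∣p∣+∣q∣ (outside ∷ p) (outside ∷ q) = ∣p∪q∣≤∣p∣+∣q∣ p q

≤∣∁p∣⇒∣p∣≤n∸ : ∀ {N m} (p : Subset N) → m ≤ ∣ ∁ p ∣ → ∣ p ∣ ≤ N ∸ m
≤∣∁p∣⇒∣p∣≤n∸ {N} {m} p m≤∣∁p∣ = m+n≤o⇒m≤o∸n ∣ p ∣ (subst (_≤ N) (+-comm m ∣ p ∣) m+∣p∣≤N)
  where
  m+∣p∣≤N : m + ∣ p ∣ ≤ N
  m+∣p∣≤N = m≤o∸n⇒m+n≤o m (∣p∣≤n p) (subst (m ≤_) (∣∁p∣≡n∸∣p∣ p) m≤∣∁p∣)

injection⇒≤∣p∣ : ∀ {m N} {p : Subset N} (f : Fin m → Fin N) → Injective _≡_ _≡_ f → (∀ j → f j ∈ p) → m ≤ ∣ p ∣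
injection⇒≤∣p∣ {zero}  f f-inj f∈p = z≤n
injection⇒≤∣p∣ {suc m} f f-inj f∈p =
  ≤-trans (s≤s (injection⇒≤∣p∣ (f ∘ fsuc) (Finₚ.suc-injective ∘ f-inj) f∘suc∈p-f0)) (x∈p⇒∣p-x∣<∣p∣ (f∈p fzero))
  where
  f∘suc∈p-f0 : ∀ j → f (fsuc j) ∈ _ - f fzero
  f∘suc∈p-f0 j = x∈p∧x≢y⇒x∈p-y (f∈p (fsuc j)) (λ eq → Finₚ.0≢1+n (≡-sym (f-inj eq)))

argmax-∈ : ∀ {N} (g : Fin N → ℕ) (S : Subset N) (b : ℕ) → (∀ {y} → y ∈ S → g y ≤ b) →
           Empty S ⊎ ∃ λ y → y ∈ S × (∀ {y′} → y′ ∈ S → g y′ ≤ g y)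
argmax-∈ g S b g≤b with Finₚ.any? (λ y → (y ∈? S) ×-dec (g y ≟ b))
... | yes (y , y∈S , gy≡b) = inj₂ (y , y∈S , λ y′∈S → subst (_ ≤_) (≡-sym gy≡b) (g≤b y′∈S))
argmax-∈ g S zero    g≤b | no ∄ = inj₁ λ (y , y∈S) → ∄ (y , y∈S , n≤0⇒n≡0 (g≤b y∈S))
argmax-∈ g S (suc b) g≤b | no ∄ =
  argmax-∈ g S b λ {y} y∈S → ≤-pred (≤∧≢⇒< (g≤b y∈S) (λ gy≡b → ∄ (y , y∈S , gy≡b)))

module Walks (G : Graph) where

  private
    variable
      a b c v y : Fin (n G)
      k l : ℕ

  _++ʷ_ : Walk G a b → Walk G b c → Walk G a c
  here _     ++ʷ q = q
  step a e p ++ʷ q = step a e (p ++ʷ q)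

  len-++ʷ : (p : Walk G a b) (q : Walk G b c) → len (p ++ʷ q) ≡ len p + len q
  len-++ʷ (here _)     q = refl
  len-++ʷ (step _ _ p) q = cong suc (len-++ʷ p q)

  reverse : Walk G a b → Walk G b a
  reverse (here a)     = here a
  reverse (step a e w) = reverse w ++ʷ step _ (subst T (sym G a _) e) (here a)

  connected-from : (x : Fin (n G)) → (∀ y → Walk G x y) → Connected G
  connected-from x walk a b = reverse (walk a) ++ʷ walk b

  source-∈-vertices : (w : Walk G a b) → a List.∈ vertices w
  source-∈-vertices (here _)     = here refl
  source-∈-vertices (step _ _ _) = here refl

  split-at : (w : Walk G a b) (j : ℕ) → j ≤ len w →
             ∃ λ v → v List.∈ vertices w × Σ (Walk G a v) λ p → Σ (Walk G v b) λ q → len p ≡ j × len p + len q ≡ len w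
  split-at {a} w zero _ = a , source-∈-vertices w , here a , w , refl , refl
  split-at (step a e w) (suc j) (s≤s j≤w) with split-at w j j≤w
  ... | v , v∈w , p , q , |p|≡j , |p|+|q|≡|w| = v , there v∈w , step a e p , q , cong suc |p|≡j , cong suc |p|+|q|≡|w|

  split-at-∈ : (w : Walk G a b) → v List.∈ vertices w →
               Σ (Walk G a v) λ p → Σ (Walk G v b) λ q → len p + len q ≡ len w
  split-at-∈ (here a)     (here refl) = here a , here a , refl
  split-at-∈ (step a e w) (here refl) = here a , step a e w , refl
  split-at-∈ (step a e w) (there v∈w) with split-at-∈ w v∈w
  ... | p , q , |p|+|q|≡|w| = step a e p , q , cong suc |p|+|q|≡|w|

  WalkOfLength≤ : ℕ → Fin (n G) → Fin (n G) → Set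
  WalkOfLength≤ k a b = Σ (Walk G a b) λ w → len w ≤ k

  walkOfLength≤? : ∀ k a b → Dec (WalkOfLength≤ k a b)
  walkOfLength≤? k a b with a Finₚ.≟ b
  ... | yes refl = yes (here a , z≤n)
  walkOfLength≤? zero    a b | no a≢b = no λ { (here _ , _) → a≢b refl ; (step _ _ _ , ()) }
  walkOfLength≤? (suc k) a b | no a≢b with Finₚ.any? (λ c → T? (adj G a c) ×-dec walkOfLength≤? k c b)
  ... | yes (c , e , w , |w|≤k) = yes (step a e w , s≤s |w|≤k)
  ... | no ∄ = no λ { (here _ , _) → a≢b refl ; (step _ e w , s≤s |w|≤k) → ∄ (_ , e , w , |w|≤k) }

  -- Descends from k while a walk of length ≤ k − 1 exists; where it stops, k is the distance.
  walk⇒distance : ∀ k → WalkOfLength≤ k a b → ∃ (IsDist G a b)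
  walk⇒distance zero    (w , |w|≤0) = 0 , (w , n≤0⇒n≡0 |w|≤0) , λ _ → z≤n
  walk⇒distance {a} {b} (suc k) (w , |w|≤1+k) with walkOfLength≤? k a b
  ... | yes shorter = walk⇒distance k shorter
  ... | no ∄shorter = suc k , (w , ≤-antisym |w|≤1+k (1+k≤ w)) , 1+k≤
    where
    1+k≤ : ∀ w′ → suc k ≤ len w′
    1+k≤ w′ = ≰⇒> λ |w′|≤k → ∄shorter (w′ , |w′|≤k)

  IsDist-unique : IsDist G a b k → IsDist G a b l → k ≡ l
  IsDist-unique ((w , |w|≡k) , k≤) ((w′ , |w′|≡l) , l≤) =
    ≤-antisym (subst (_ ≤_) |w′|≡l (k≤ w′)) (subst (_ ≤_) |w|≡k (l≤ w))

module Distances (G : Graph) (connected : Connected G) (x : Fin (n G)) where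

  open Walks G

  private
    variable
      v y : Fin (n G)

  distance : ∀ y → ∃ (IsDist G x y)
  distance y = walk⇒distance (len (connected x y)) (connected x y , ≤-refl)

  dist : Fin (n G) → ℕ
  dist y = proj₁ (distance y)

  geodesic : ∀ y → Walk G x y
  geodesic y = proj₁ (proj₁ (proj₂ (distance y)))

  len-geodesic : ∀ y → len (geodesic y) ≡ dist y
  len-geodesic y = proj₂ (proj₁ (proj₂ (distance y)))

  dist≤len : (w : Walk G x y) → dist y ≤ len w
  dist≤len {y} = proj₂ (proj₂ (distance y))

  geodesic-isShortest : ∀ y → IsShortest (geodesic y)
  geodesic-isShortest y w = subst (_≤ len w) (≡-sym (len-geodesic y)) (dist≤len w)

  dist-triangle : (q : Walk G v y) → dist y ≤ dist v + len q
  dist-triangle {v} {y} q = begin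
    dist y                      ≤⟨ dist≤len (geodesic v ++ʷ q) ⟩
    len (geodesic v ++ʷ q)      ≡⟨ len-++ʷ (geodesic v) q ⟩
    len (geodesic v) + len q    ≡⟨ cong (_+ len q) (len-geodesic v) ⟩
    dist v + len q              ∎
    where open ≤-Reasoning

  dist-self : dist x ≡ 0
  dist-self = n≤0⇒n≡0 (dist≤len (here x))

  dist≡0⇒≡ : dist y ≡ 0 → x ≡ y
  dist≡0⇒≡ {y} dy≡0 with geodesic y | trans (len-geodesic y) dy≡0
  ... | here _     | _  = refl
  ... | step _ _ _ | ()

  shortest⇒len≡dist : {P : Walk G x y} → IsShortest P → len P ≡ dist y
  shortest⇒len≡dist {y} {P} P-shortest = ≤-antisym (subst (len P ≤_) (len-geodesic y) (P-shortest (geodesic y))) (dist≤len P)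

  dist-on-geodesic : (P : Walk G x y) → len P ≡ dist y →
                     (p : Walk G x v) (q : Walk G v y) → len p + len q ≡ len P → dist v ≡ len p
  dist-on-geodesic {y} {v} P |P|≡dy p q |p|+|q|≡|P| = ≤-antisym (dist≤len p) (+-cancelʳ-≤ (len q) (len p) (dist v) (begin
    len p + len q    ≡⟨ |p|+|q|≡|P| ⟩
    len P            ≡⟨ |P|≡dy ⟩
    dist y           ≤⟨ dist-triangle q ⟩
    dist v + len q   ∎))
    where open ≤-Reasoning

  geodesic-vertex-at : (P : Walk G x y) → len P ≡ dist y → ∀ j → j ≤ dist y → ∃ λ u → u List.∈ vertices P × dist u ≡ j
  geodesic-vertex-at P |P|≡dy j j≤dy with split-at P j (subst (j ≤_) (≡-sym |P|≡dy) j≤dy)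
  ... | u , u∈P , p , q , |p|≡j , |p|+|q|≡|P| = u , u∈P , trans (dist-on-geodesic P |P|≡dy p q |p|+|q|≡|P|) |p|≡j

  geodesic-vertex-closer : (P : Walk G x y) → len P ≡ dist y → v List.∈ vertices P → v ≡ y ⊎ dist v < dist y
  geodesic-vertex-closer {y} {v} P |P|≡dy v∈P with split-at-∈ P v∈P
  ... | p , here _ , _ = inj₁ refl
  ... | p , q@(step _ _ _) , |p|+|q|≡|P| = inj₂ (begin-strict
    dist v           ≡⟨ dist-on-geodesic P |P|≡dy p q |p|+|q|≡|P| ⟩
    len p            <⟨ m<m+n (len p) z<s ⟩
    len p + len q    ≡⟨ |p|+|q|≡|P| ⟩
    len P            ≡⟨ |P|≡dy ⟩
    dist y           ∎)
    where open ≤-Reasoning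

  dist≤ecc : ∀ {e} → IsEcc G x e → ∀ y → dist y ≤ e
  dist≤ecc (dist≤e , _) y = dist≤e y (dist y) (proj₂ (distance y))

  Layer : ℕ → Subset (n G)
  Layer i = satisfying (λ y → dist y ≟ i)

  ∈-Layer⁻ : ∀ {i} → y ∈ Layer i → dist y ≡ i
  ∈-Layer⁻ {i = i} = ∈-satisfying⁻ (λ y → dist y ≟ i)

  ∈-Layer⁺ : ∀ {i} → dist y ≡ i → y ∈ Layer i
  ∈-Layer⁺ {i = i} = ∈-satisfying⁺ (λ y → dist y ≟ i)

  Layer-isVisSet : ∀ {i} → 1 ≤ i → IsVisSet G x (Layer i)
  Layer-isVisSet {i} 1≤i = x∉Layer , λ y y∈Layer → geodesic y , geodesic-isShortest y , only-y y∈Layer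
    where
    x∉Layer : x ∉ Layer i
    x∉Layer x∈Layer = <-irrefl (trans (≡-sym dist-self) (∈-Layer⁻ x∈Layer)) 1≤i
    only-y : y ∈ Layer i → ∀ v → v List.∈ vertices (geodesic y) → v ∈ Layer i → v ≡ y
    only-y {y} y∈Layer v v∈P v∈Layer with geodesic-vertex-closer (geodesic y) (len-geodesic y) v∈P
    ... | inj₁ v≡y   = v≡y
    ... | inj₂ dv<dy = ⊥-elim (<-irrefl (trans (∈-Layer⁻ v∈Layer) (≡-sym (∈-Layer⁻ y∈Layer))) dv<dy)

  Layers≤ : ℕ → Subset (n G)
  Layers≤ zero    = ⊥
  Layers≤ (suc m) = Layer (suc m) ∪ Layers≤ m

  ∈-Layers≤ : ∀ {m} → 1 ≤ dist y → dist y ≤ m → y ∈ Layers≤ m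
  ∈-Layers≤ {m = zero}  1≤dy dy≤0   = ⊥-elim (<-irrefl refl (<-≤-trans 1≤dy dy≤0))
  ∈-Layers≤ {m = suc m} 1≤dy dy≤1+m with m≤n⇒m<n∨m≡n dy≤1+m
  ... | inj₁ dy<1+m = x∈p∪q⁺ (inj₂ (∈-Layers≤ 1≤dy (≤-pred dy<1+m)))
  ... | inj₂ dy≡1+m = x∈p∪q⁺ (inj₁ (∈-Layer⁺ dy≡1+m))

  ∣Layers≤∣≤ : ∀ {v} → (∀ i → 1 ≤ i → ∣ Layer i ∣ ≤ v) → ∀ m → ∣ Layers≤ m ∣ ≤ m * v
  ∣Layers≤∣≤ _         zero    = ≤-reflexive (∣⊥∣≡0 (n G))
  ∣Layers≤∣≤ ∣Layer∣≤v (suc m) =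
    ≤-trans (∣p∪q∣≤∣p∣+∣q∣ (Layer (suc m)) (Layers≤ m)) (+-mono-≤ (∣Layer∣≤v (suc m) (s≤s z≤n)) (∣Layers≤∣≤ ∣Layer∣≤v m))

  n∸1≤v*ecc : ∀ {e v} → IsEcc G x e → IsVisNumber G x v → n G ∸ 1 ≤ v * e
  n∸1≤v*ecc {e} {v} ecc (_ , ∣S∣≤v) = begin
    n G ∸ 1          ≡⟨ cong (n G ∸_) (≡-sym (∣⁅x⁆∣≡1 x)) ⟩
    n G ∸ ∣ ⁅ x ⁆ ∣  ≡⟨ ≡-sym (∣∁p∣≡n∸∣p∣ ⁅ x ⁆) ⟩
    ∣ ∁ ⁅ x ⁆ ∣      ≤⟨ p⊆q⇒∣p∣≤∣q∣ ∁⁅x⁆⊆Layers≤e ⟩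
    ∣ Layers≤ e ∣    ≤⟨ ∣Layers≤∣≤ (λ i 1≤i → ∣S∣≤v (Layer i) (Layer-isVisSet 1≤i)) e ⟩
    e * v            ≡⟨ *-comm e v ⟩
    v * e            ∎
    where
    open ≤-Reasoning
    ∁⁅x⁆⊆Layers≤e : ∁ ⁅ x ⁆ ⊆ Layers≤ e
    ∁⁅x⁆⊆Layers≤e {y} y∈∁⁅x⁆ = ∈-Layers≤ (n≢0⇒n>0 dy≢0) (dist≤ecc ecc y)
      where
      dy≢0 : dist y ≢ 0
      dy≢0 dy≡0 = x∈∁p⇒x∉p y∈∁⁅x⁆ (subst (_∈ ⁅ x ⁆) (dist≡0⇒≡ dy≡0) (x∈⁅x⁆ x))

  module _ {S e} (S-visible : IsVisSet G x S) (ecc : IsEcc G x e) where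

    vertex-off-visSet-at : ∀ {y₀} → y₀ ∈ S → (∀ {y} → y ∈ S → dist y ≤ dist y₀) →
                           ∀ i → i ≤ e → i ≢ dist y₀ → ∃ λ u → u ∉ S × dist u ≡ i
    vertex-off-visSet-at {y₀} y₀∈S farthest i i≤e i≢d₀ with i <? dist y₀
    ... | yes i<d₀ = below
      where
      below : ∃ λ u → u ∉ S × dist u ≡ i
      below with proj₂ S-visible y₀ y₀∈S
      ... | P , P-shortest , P∩S⊆y₀ with geodesic-vertex-at P (shortest⇒len≡dist P-shortest) i (<⇒≤ i<d₀)
      ... | u , u∈P , du≡i = u , (λ u∈S → i≢d₀ (trans (≡-sym du≡i) (cong dist (P∩S⊆y₀ u u∈P u∈S)))) , du≡i
    ... | no i≮d₀ = above
      where
      z : Fin (n G)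
      z = proj₁ (proj₂ ecc)
      dz≡e : dist z ≡ e
      dz≡e = IsDist-unique (proj₂ (distance z)) (proj₂ (proj₂ ecc))
      above : ∃ λ u → u ∉ S × dist u ≡ i
      above with geodesic-vertex-at (geodesic z) (len-geodesic z) i (subst (i ≤_) (≡-sym dz≡e) i≤e)
      ... | u , _ , du≡i = u , (λ u∈S → i≮d₀ (≤∧≢⇒< (subst (_≤ dist y₀) du≡i (farthest u∈S)) i≢d₀)) , du≡i

    e≤∣∁visSet∣ : ∀ {y₀} → y₀ ∈ S → (∀ {y} → y ∈ S → dist y ≤ dist y₀) → e ≤ ∣ ∁ S ∣
    e≤∣∁visSet∣ {y₀} y₀∈S farthest = injection⇒≤∣p∣ f f-injective (λ j → x∉p⇒x∈∁p (proj₁ (proj₂ (off j))))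
      where
      -- punchIn d̂₀ enumerates the levels 0, …, e other than d₀.
      d̂₀ : Fin (suc e)
      d̂₀ = fromℕ< (s≤s (dist≤ecc ecc y₀))
      level : Fin e → ℕ
      level j = toℕ (punchIn d̂₀ j)
      off : ∀ j → ∃ λ u → u ∉ S × dist u ≡ level j
      off j = vertex-off-visSet-at y₀∈S farthest (level j) (≤-pred (Finₚ.toℕ<n (punchIn d̂₀ j))) level≢d₀
        where
        level≢d₀ : level j ≢ dist y₀
        level≢d₀ eq = Finₚ.punchInᵢ≢i d̂₀ j (Finₚ.toℕ-injective (trans eq (≡-sym (Finₚ.toℕ-fromℕ< _))))
      f : Fin e → Fin (n G)
      f j = proj₁ (off j)
      f-injective : Injective _≡_ _≡_ f
      f-injective {i} {j} fi≡fj = Finₚ.punchIn-injective d̂₀ i j (Finₚ.toℕ-injective (begin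
        level i     ≡⟨ ≡-sym (proj₂ (proj₂ (off i))) ⟩
        dist (f i)  ≡⟨ cong dist fi≡fj ⟩
        dist (f j)  ≡⟨ proj₂ (proj₂ (off j)) ⟩
        level j     ∎))
        where open ≡-Reasoning

    ∣visSet∣≤n∸ecc : ∣ S ∣ ≤ n G ∸ e
    ∣visSet∣≤n∸ecc with argmax-∈ dist S e (λ {y} _ → dist≤ecc ecc y)
    ... | inj₁ S-empty = subst (_≤ n G ∸ e) (≡-sym (trans (cong ∣_∣ (Empty-unique S-empty)) (∣⊥∣≡0 (n G)))) z≤n
    ... | inj₂ (y₀ , y₀∈S , farthest) = ≤∣∁p∣⇒∣p∣≤n∸ S (e≤∣∁visSet∣ y₀∈S farthest)

1+n≡ᵇn : ∀ m → (suc m ≡ᵇ m) ≡ false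
1+n≡ᵇn zero    = refl
1+n≡ᵇn (suc m) = 1+n≡ᵇn m

module Path (k : ℕ) where

  path : Graph
  path = record
    { n      = suc k
    ; adj    = λ i j → (suc (toℕ i) ≡ᵇ toℕ j) ∨ (suc (toℕ j) ≡ᵇ toℕ i)
    ; irrefl = λ i → cong₂ _∨_ (1+n≡ᵇn (toℕ i)) (1+n≡ᵇn (toℕ i))
    ; sym    = λ i j → ∨-comm (suc (toℕ i) ≡ᵇ toℕ j) (suc (toℕ j) ≡ᵇ toℕ i)
    }

  open Walks path

  Adj⇒≤1+ : ∀ {a b} → Adj path a b → toℕ b ≤ suc (toℕ a)
  Adj⇒≤1+ {a} {b} e with Equivalence.to (T-∨ {suc (toℕ a) ≡ᵇ toℕ b} {suc (toℕ b) ≡ᵇ toℕ a}) e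
  ... | inj₁ 1+a≡b = ≤-reflexive (≡-sym (≡ᵇ⇒≡ _ _ 1+a≡b))
  ... | inj₂ 1+b≡a = ≤-trans (n≤1+n (toℕ b)) (≤-trans (≤-reflexive (≡ᵇ⇒≡ _ _ 1+b≡a)) (n≤1+n (toℕ a)))

  toℕ≤toℕ+len : ∀ {a b} (w : Walk path a b) → toℕ b ≤ toℕ a + len w
  toℕ≤toℕ+len {a} (here _) = m≤m+n (toℕ a) 0
  toℕ≤toℕ+len {a} {b} (step {a′} _ e w) = begin
    toℕ b                ≤⟨ toℕ≤toℕ+len w ⟩
    toℕ a′ + len w       ≤⟨ +-monoˡ-≤ (len w) (Adj⇒≤1+ e) ⟩
    suc (toℕ a) + len w  ≡⟨ ≡-sym (+-suc (toℕ a) (len w)) ⟩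
    toℕ a + suc (len w)  ∎
    where open ≤-Reasoning

  walk-from-0 : ∀ m (m<1+k : m < suc k) → Σ (Walk path fzero (fromℕ< m<1+k)) λ w → len w ≡ m
  walk-from-0 zero    _       = here fzero , refl
  walk-from-0 (suc m) 1+m<1+k with walk-from-0 m (<-trans (n<1+n m) 1+m<1+k)
  ... | w , |w|≡m = w ++ʷ step _ edge (here _) , trans (len-++ʷ w _) (trans (+-comm (len w) 1) (cong suc |w|≡m))
    where
    edge : Adj path (fromℕ< (<-trans (n<1+n m) 1+m<1+k)) (fromℕ< 1+m<1+k)
    edge = Equivalence.from T-∨ (inj₁ (≡⇒≡ᵇ _ _ (trans (cong suc (Finₚ.toℕ-fromℕ< _)) (≡-sym (Finₚ.toℕ-fromℕ< 1+m<1+k)))))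

  dist-from-0 : ∀ y → IsDist path fzero y (toℕ y)
  dist-from-0 y = subst (λ y′ → IsDist path fzero y′ (toℕ y)) (Finₚ.fromℕ<-toℕ y (Finₚ.toℕ<n y))
                        (walk-from-0 (toℕ y) (Finₚ.toℕ<n y) , λ w → subst (_≤ len w) (Finₚ.toℕ-fromℕ< _) (toℕ≤toℕ+len w))

  path-connected : Connected path
  path-connected = connected-from fzero (λ y → proj₁ (proj₁ (dist-from-0 y)))

  ecc-0 : IsEcc path fzero k
  ecc-0 = (λ y l l-dist → subst (_≤ k) (IsDist-unique (dist-from-0 y) l-dist) (≤-pred (Finₚ.toℕ<n y)))
        , fromℕ k , subst (IsDist path fzero (fromℕ k)) (Finₚ.toℕ-fromℕ k) (dist-from-0 (fromℕ k))

  visNumber-0 : 1 ≤ k → IsVisNumber path fzero 1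
  visNumber-0 1≤k = (⁅ fromℕ k ⁆ , (0∉⁅k⁆ , visible) , ∣⁅x⁆∣≡1 (fromℕ k)) , ∣visSet∣≤1
    where
    0∉⁅k⁆ : fzero ∉ ⁅ fromℕ k ⁆
    0∉⁅k⁆ 0∈⁅k⁆ = <-irrefl (trans (cong toℕ (x∈⁅y⁆⇒x≡y (fromℕ k) 0∈⁅k⁆)) (Finₚ.toℕ-fromℕ k)) 1≤k
    visible : ∀ y → y ∈ ⁅ fromℕ k ⁆ →
              Σ (Walk path fzero y) λ P → IsShortest P × (∀ v → v List.∈ vertices P → v ∈ ⁅ fromℕ k ⁆ → v ≡ y)
    visible y y∈⁅k⁆ with dist-from-0 y
    ... | (P , |P|≡y) , y≤ = P , (λ w → subst (_≤ len w) (≡-sym |P|≡y) (y≤ w))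
                           , λ v _ v∈⁅k⁆ → trans (x∈⁅y⁆⇒x≡y _ v∈⁅k⁆) (≡-sym (x∈⁅y⁆⇒x≡y _ y∈⁅k⁆))
    ∣visSet∣≤1 : ∀ S → IsVisSet path fzero S → ∣ S ∣ ≤ 1
    ∣visSet∣≤1 S S-visible = subst (∣ S ∣ ≤_) (m+n∸n≡m 1 k) (Distances.∣visSet∣≤n∸ecc path path-connected fzero S-visible ecc-0)

open Path using (path; path-connected; ecc-0; visNumber-0)

proposition3p5 : ((G : Graph) → Connected G → (x : Fin (n G)) → (e v : ℕ) →
    IsEcc G x e → IsVisNumber G x v →
    (n G ∸ 1 ≤ v * e) × (v ≤ n G ∸ e))
    ×
    ((k : ℕ) → 1 ≤ k →
    Σ Graph (λ G → Connected G × Σ (Fin (n G)) (λ x → ∃ (λ v →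
    IsEcc G x k × IsVisNumber G x v × n G ∸ 1 ≡ v * k))))
    ×
    ((k : ℕ) → 1 ≤ k →
    Σ Graph (λ G → Connected G × Σ (Fin (n G)) (λ x → ∃ (λ v →
    IsEcc G x k × IsVisNumber G x v × v ≡ n G ∸ k))))
proposition3p5 =
    (λ G connected x e v ecc visNumber@((_ , S-visible , ∣S∣≡v) , _) →
        Distances.n∸1≤v*ecc G connected x ecc visNumber
      , subst (_≤ n G ∸ e) ∣S∣≡v (Distances.∣visSet∣≤n∸ecc G connected x S-visible ecc))
  , (λ k 1≤k → path k , path-connected k , fzero , 1 , ecc-0 k , visNumber-0 k 1≤k , ≡-sym (+-identityʳ k))
  , (λ k 1≤k → path k , path-connected k , fzero , 1 , ecc-0 k , visNumber-0 k 1≤k , ≡-sym (m+n∸n≡m 1 k))
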